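{- Let $m\geqslant1$ and let $i,j,k,p,q$ be five distinct rows of a Hadamard matrix $H$ of order $4m$. Then $T_{ijkp}+T_{ijkq}\geqslant m/2$. Moreover, if $T_{ijkp}+T_{ijkq}=m/2$, then, writing $t=T_{ijkp}$, $s=T_{ijkq}$, $t'=m/2-t$ and $s'=m/2-s$, after a suitable sequence of negations of these rows, negations of columns and permutations of columns, the columns can be partitioned into twelve consecutive blocks of sizes $$\tfrac m2,\ t',\ s',\ t,\ s,\ \tfrac m2,\ t,\ s,\ \tfrac m2,\ \tfrac m2,\ t',\ s'$$ (in this order) such that each of the five rows is constant on each block, with the signs on the twelve blocks given by $$\begin{array}{rl} i: & +\,+\,+\,+\,+\,+\,+\,+\,+\,+\,+\,+\\ j: & +\,+\,+\,+\,+\,+\,-\,-\,-\,-\,-\,-\\ k: & +\,+\,+\,-\,-\,-\,+\,+\,+\,-\,-\,-\\ p: & +\,+\,-\,+\,-\,-\,+\,-\,-\,+\,+\,-\\ q: & +\,-\,+\,-\,+\,-\,-\,+\,-\,+\,-\,+ \end{array}$$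
   Context: A Hadamard matrix of order $n$ is an $n\times n$ matrix $H=(h_{uv})$ with entries in $\{ -1,1\}$ such that $HH^\top=nI$. For four distinct rows $i,j,k,\ell$ of $H$, put $P_{ijk\ell}=\left|\sum_{r=1}^n h_{ir}h_{jr}h_{kr}h_{\ell r}\right|$; the type of the quadruple $\{i,j,k,\ell\}$ is $T_{ijk\ell}=\frac{n-P_{ijk\ell}}{8}$. -}

module Defs where

open import Data.Nat as ℕ using (ℕ; zero; suc)
open import Data.Integer as ℤ using (ℤ; +_; -_; ∣_∣)
open import Data.Rational as ℚ using (ℚ)
open import Data.Fin as Fin using (Fin)
open import Data.Fin.Permutation using (Permutation′; _⟨$⟩ʳ_)
open import Data.Bool using (Bool; true; false; if_then_else_)
open import Data.List using (List; length; filter)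
open import Data.Fin.Base using () renaming (_≤_ to _≤ᶠ_)
open import Data.Vec as Vec using (Vec; []; _∷_; lookup)
open import Data.Product using (_×_; Σ-syntax; ∃-syntax)
open import Data.Sum using (_⊎_)
open import Relation.Binary.PropositionalEquality using (_≡_; _≢_)
open import Relation.Nullary.Decidable using (⌊_⌋)

∑ : (n : ℕ) → (Fin n → ℤ) → ℤ
∑ zero    f = + 0
∑ (suc n) f = f Fin.zero ℤ.+ ∑ n (λ r → f (Fin.suc r))

count : (n : ℕ) → (Fin n → Bool) → ℕ
count zero    f = 0
count (suc n) f with f Fin.zero
... | true  = suc (count n (λ r → f (Fin.suc r)))
... | false = count n (λ r → f (Fin.suc r))

Matrix : ℕ → Set
Matrix n = Fin n → Fin n → ℤ

diagVal : (n : ℕ) → Fin n → Fin n → ℤ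
diagVal n u w = if ⌊ u Fin.≟ w ⌋ then (+ n) else (+ 0)

IsHadamard : (n : ℕ) → Matrix n → Set
IsHadamard n H =
  (∀ u v → H u v ≡ + 1 ⊎ H u v ≡ - (+ 1)) ×
  (∀ u w → ∑ n (λ r → H u r ℤ.* H w r) ≡ diagVal n u w)

P : (n : ℕ) → Matrix n → Fin n → Fin n → Fin n → Fin n → ℕ
P n H i j k l = ∣ ∑ n (λ r → H i r ℤ.* H j r ℤ.* H k r ℤ.* H l r) ∣

T : (n : ℕ) → Matrix n → Fin n → Fin n → Fin n → Fin n → ℚ
T n H i j k l = (+ n ℤ.- + P n H i j k l) ℚ./ 8

sgn : Bool → ℤ
sgn true  = + 1
sgn false = - (+ 1)

-- the sign table; rows 0..4 correspond to i, j, k, p, q; columns to the 12 blocks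
signTable : Vec (Vec Bool 12) 5
signTable =
  (t ∷ t ∷ t ∷ t ∷ t ∷ t ∷ t ∷ t ∷ t ∷ t ∷ t ∷ t ∷ []) ∷
  (t ∷ t ∷ t ∷ t ∷ t ∷ t ∷ f ∷ f ∷ f ∷ f ∷ f ∷ f ∷ []) ∷
  (t ∷ t ∷ t ∷ f ∷ f ∷ f ∷ t ∷ t ∷ t ∷ f ∷ f ∷ f ∷ []) ∷
  (t ∷ t ∷ f ∷ t ∷ f ∷ f ∷ t ∷ f ∷ f ∷ t ∷ t ∷ f ∷ []) ∷
  (t ∷ f ∷ t ∷ f ∷ t ∷ f ∷ f ∷ t ∷ f ∷ t ∷ f ∷ t ∷ []) ∷ []
  where
  t = true
  f = false

sign : Fin 5 → Fin 12 → Bool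
sign a b = lookup (lookup signTable a) b

blockSizes : ℕ → ℚ → ℚ → Vec ℚ 12
blockSizes m t s =
  h ∷ t′ ∷ s′ ∷ t ∷ s ∷ h ∷ t ∷ s ∷ h ∷ h ∷ t′ ∷ s′ ∷ []
  where
  h  = + m ℚ./ 2
  t′ = h ℚ.- t
  s′ = h ℚ.- s

rows5 : {n : ℕ} → Fin n → Fin n → Fin n → Fin n → Fin n → Fin 5 → Fin n
rows5 i j k p q a = lookup (i ∷ j ∷ k ∷ p ∷ q ∷ []) a

Distinct5 : {n : ℕ} → Fin n → Fin n → Fin n → Fin n → Fin n → Set
Distinct5 i j k p q =
  i ≢ j × i ≢ k × i ≢ p × i ≢ q ×
  j ≢ k × j ≢ p × j ≢ q ×
  k ≢ p × k ≢ q ×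
  p ≢ q

-- After negating some of the five rows (ε), negating some columns (δ) and
-- permuting columns (σ), the transformed matrix H' (restricted to the five
-- rows) is  H'(a, c) = ε a · δ c · H (row a) (σ c).
-- The columns are split into 12 consecutive blocks (in this order) via a
-- monotone map blk : Fin n → Fin 12, block b having exactly the prescribed
-- size, and each of the five rows is constant on each block with the
-- prescribed sign.
BlockStructure : (m : ℕ) → Matrix (4 ℕ.* m) →
                 (i j k p q : Fin (4 ℕ.* m)) → ℚ → ℚ → Set
BlockStructure m H i j k p q t s =
  Σ[ ε ∈ (Fin 5 → Bool) ] Σ[ δ ∈ (Fin (4 ℕ.* m) → Bool) ]
  Σ[ σ ∈ Permutation′ (4 ℕ.* m) ] Σ[ blk ∈ (Fin (4 ℕ.* m) → Fin 12) ]
    (∀ c d → c ≤ᶠ d → blk c ≤ᶠ blk d) ×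
    (∀ b → + count (4 ℕ.* m) (λ c → ⌊ blk c Fin.≟ b ⌋) ℚ./ 1
             ≡ lookup (blockSizes m t s) b) ×
    (∀ a c → sgn (ε a) ℤ.* sgn (δ c) ℤ.* H (rows5 i j k p q a) (σ ⟨$⟩ʳ c)
             ≡ sgn (sign a (blk c)))

-- Negate the columns on which row i is −1, and negate rows p and q when their quadruple sums
-- Σ h_i h_j h_k h_p and Σ h_i h_j h_k h_q are negative. Row i becomes all ones, the five rows stay
-- pairwise orthogonal, and the columnwise products u = h_j h_k h_p and v = h_j h_k h_q have sums
-- P_ijkp and P_ijkq. Each column contributes (1 − u)(1 − v) ≥ 0, and as uv = h_p h_q, orthogonality
-- gives Σ (1 − u)(1 − v) = n − P_ijkp − P_ijkq: this is the inequality. In the equality case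
-- (1 − u)(1 − v) = 0 on every column, so each column is one of the twelve columns of the sign table.
-- Sixteen times the indicator of a table column is a product of factors 1 ± entry; after expanding,
-- orthogonality leaves only n, P_ijkp and P_ijkq, which gives the twelve block sizes. Sorting the
-- columns by block makes the blocks consecutive.

module Submission where

open import Defs
open import Data.Nat as ℕ using (ℕ)
open import Data.Integer as ℤ using (ℤ; +_)
open import Data.Fin using (Fin; #_)
open import Relation.Binary.PropositionalEquality using (_≡_; _≢_)

module FiniteSums where

  open import Data.Nat using (ℕ; zero; suc)
  import Data.Nat.Properties as ℕₚ
  open import Data.Integer using (ℤ; +_; -_; _+_; _-_; _*_; _≤_; +≤+; nonNegative)
  import Data.Integer.Properties as ℤₚ
  open import Data.Integer.Tactic.RingSolver using (solve-∀)
  open import Algebra.Properties.CommutativeSemigroup ℤₚ.+-commutativeSemigroup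
    using () renaming (interchange to +-interchange; x∙yz≈y∙xz to +-exchange)
  open import Data.Fin as Fin using (Fin; toℕ; punchIn)
  open import Data.Fin.Permutation as Perm using (Permutation′; _⟨$⟩ʳ_; insert)
  open import Data.Bool using (Bool; true; false)
  open import Data.Product using (Σ-syntax; _×_; _,_)
  open import Data.Sum using (inj₁; inj₂)
  open import Function using (_∘_)
  open import Relation.Binary.PropositionalEquality
  open ≡-Reasoning

  ∑-cong : ∀ n {f g : Fin n → ℤ} → (∀ r → f r ≡ g r) → ∑ n f ≡ ∑ n g
  ∑-cong zero    f≗g = refl
  ∑-cong (suc n) f≗g = cong₂ _+_ (f≗g Fin.zero) (∑-cong n (f≗g ∘ Fin.suc))

  ∑-distrib-+ : ∀ n (f g : Fin n → ℤ) → ∑ n (λ r → f r + g r) ≡ ∑ n f + ∑ n g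
  ∑-distrib-+ zero    f g = refl
  ∑-distrib-+ (suc n) f g = begin
    f₀ + g₀ + ∑ n (λ r → f (Fin.suc r) + g (Fin.suc r))
      ≡⟨ cong (_+_ (f₀ + g₀)) (∑-distrib-+ n (f ∘ Fin.suc) (g ∘ Fin.suc)) ⟩
    f₀ + g₀ + (∑ n (f ∘ Fin.suc) + ∑ n (g ∘ Fin.suc))
      ≡⟨ +-interchange f₀ g₀ _ _ ⟩
    f₀ + ∑ n (f ∘ Fin.suc) + (g₀ + ∑ n (g ∘ Fin.suc)) ∎
    where
    f₀ = f Fin.zero
    g₀ = g Fin.zero

  ∑-*ˡ : ∀ n c (f : Fin n → ℤ) → ∑ n (λ r → c * f r) ≡ c * ∑ n f
  ∑-*ˡ zero    c f = sym (ℤₚ.*-zeroʳ c)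
  ∑-*ˡ (suc n) c f = trans (cong (_+_ (c * f Fin.zero)) (∑-*ˡ n c (f ∘ Fin.suc)))
                           (sym (ℤₚ.*-distribˡ-+ c (f Fin.zero) _))

  ∑-one : ∀ n → ∑ n (λ _ → + 1) ≡ + n
  ∑-one zero    = refl
  ∑-one (suc n) = trans (cong (_+_ (+ 1)) (∑-one n)) (sym (ℤₚ.pos-+ 1 n))

  ∑-neg : ∀ n (f : Fin n → ℤ) → ∑ n (λ r → - f r) ≡ - ∑ n f
  ∑-neg n f = begin
    ∑ n (λ r → - f r)          ≡⟨ ∑-cong n (λ r → sym (ℤₚ.-1*i≡-i (f r))) ⟩
    ∑ n (λ r → - + 1 * f r)    ≡⟨ ∑-*ˡ n (- + 1) f ⟩
    - + 1 * ∑ n f              ≡⟨ ℤₚ.-1*i≡-i (∑ n f) ⟩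
    - ∑ n f                    ∎

  ∑-distrib‿- : ∀ n (f g : Fin n → ℤ) → ∑ n (λ r → f r - g r) ≡ ∑ n f - ∑ n g
  ∑-distrib‿- n f g = trans (∑-distrib-+ n f (λ r → - g r)) (cong (_+_ (∑ n f)) (∑-neg n g))

  ∑-linear : ∀ n a b c (f g h : Fin n → ℤ) →
             ∑ n (λ r → a * f r + b * g r + c * h r) ≡ a * ∑ n f + b * ∑ n g + c * ∑ n h
  ∑-linear n a b c f g h = begin
    ∑ n (λ r → a * f r + b * g r + c * h r)
      ≡⟨ ∑-distrib-+ n _ _ ⟩
    ∑ n (λ r → a * f r + b * g r) + ∑ n (λ r → c * h r)
      ≡⟨ cong₂ _+_ (∑-distrib-+ n _ _) (∑-*ˡ n c h) ⟩
    ∑ n (λ r → a * f r) + ∑ n (λ r → b * g r) + c * ∑ n h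
      ≡⟨ cong (_+ c * ∑ n h) (cong₂ _+_ (∑-*ˡ n a f) (∑-*ˡ n b g)) ⟩
    a * ∑ n f + b * ∑ n g + c * ∑ n h ∎

  -- For signs, (1 + κ₁ a)(1 + κ₂ b) is four times the indicator of a = κ₁ ∧ b = κ₂.
  ∑-quadrant : ∀ n κ₁ κ₂ (a b f : Fin n → ℤ) →
               ∑ n (λ r → a r * f r) ≡ + 0 → ∑ n (λ r → b r * f r) ≡ + 0 →
               ∑ n (λ r → a r * b r * f r) ≡ + 0 →
               ∑ n (λ r → (+ 1 + κ₁ * a r) * (+ 1 + κ₂ * b r) * f r) ≡ ∑ n f
  ∑-quadrant n κ₁ κ₂ a b f ∑af≡0 ∑bf≡0 ∑abf≡0 = begin
    ∑ n (λ r → (+ 1 + κ₁ * a r) * (+ 1 + κ₂ * b r) * f r)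
      ≡⟨ ∑-cong n (λ r → expand κ₁ κ₂ (a r) (b r) (f r)) ⟩
    ∑ n (λ r → f r + (κ₁ * af r + κ₂ * bf r + κ₁ * κ₂ * abf r))
      ≡⟨ ∑-distrib-+ n f _ ⟩
    ∑ n f + ∑ n (λ r → κ₁ * af r + κ₂ * bf r + κ₁ * κ₂ * abf r)
      ≡⟨ cong (_+_ (∑ n f)) (∑-linear n κ₁ κ₂ (κ₁ * κ₂) af bf abf) ⟩
    ∑ n f + (κ₁ * ∑ n af + κ₂ * ∑ n bf + κ₁ * κ₂ * ∑ n abf)
      ≡⟨ cong (_+_ (∑ n f)) (cong₂ _+_ (cong₂ _+_ (cong (κ₁ *_) ∑af≡0) (cong (κ₂ *_) ∑bf≡0))
                                       (cong (κ₁ * κ₂ *_) ∑abf≡0)) ⟩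
    ∑ n f + (κ₁ * + 0 + κ₂ * + 0 + κ₁ * κ₂ * + 0)
      ≡⟨ vanish (∑ n f) κ₁ κ₂ ⟩
    ∑ n f ∎
    where
    af bf abf : Fin n → ℤ
    af r = a r * f r
    bf r = b r * f r
    abf r = a r * b r * f r
    expand : ∀ k l x y z →
             (+ 1 + k * x) * (+ 1 + l * y) * z ≡ z + (k * (x * z) + l * (y * z) + k * l * (x * y * z))
    expand = solve-∀
    vanish : ∀ s k l → s + (k * + 0 + l * + 0 + k * l * + 0) ≡ s
    vanish = solve-∀

  ∑-nonNeg : ∀ n {f : Fin n → ℤ} → (∀ r → + 0 ≤ f r) → + 0 ≤ ∑ n f
  ∑-nonNeg zero    0≤f = +≤+ ℕ.z≤n
  ∑-nonNeg (suc n) 0≤f = ℤₚ.+-mono-≤ (0≤f Fin.zero) (∑-nonNeg n (0≤f ∘ Fin.suc))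

  ∑-nonNeg-≡0 : ∀ n {f : Fin n → ℤ} → (∀ r → + 0 ≤ f r) → ∑ n f ≡ + 0 → ∀ r → f r ≡ + 0
  ∑-nonNeg-≡0 (suc n) {f} 0≤f ∑≡0 = λ where
      Fin.zero    → f₀≡0
      (Fin.suc r) → ∑-nonNeg-≡0 n (0≤f ∘ Fin.suc)
                      (trans (sym (ℤₚ.+-identityˡ _)) (trans (cong (_+ ∑ n (f ∘ Fin.suc)) (sym f₀≡0)) ∑≡0)) r
    where
    f₀≡0 : f Fin.zero ≡ + 0
    f₀≡0 = ℤₚ.≤-antisym
      (subst (f Fin.zero ≤_) ∑≡0
        (ℤₚ.i≤i+j _ _ {{nonNegative (∑-nonNeg n (0≤f ∘ Fin.suc))}}))
      (0≤f Fin.zero)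

  ∑-punchIn : ∀ n (c : Fin (suc n)) (f : Fin (suc n) → ℤ) →
              ∑ (suc n) f ≡ f c + ∑ n (f ∘ punchIn c)
  ∑-punchIn n       Fin.zero    f = refl
  ∑-punchIn (suc n) (Fin.suc c) f = begin
    f₀ + ∑ (suc n) (f ∘ Fin.suc)                    ≡⟨ cong (_+_ f₀) (∑-punchIn n c (f ∘ Fin.suc)) ⟩
    f₀ + (f (Fin.suc c) + ∑ n (f ∘ Fin.suc ∘ punchIn c)) ≡⟨ +-exchange f₀ (f (Fin.suc c)) _ ⟩
    f (Fin.suc c) + (f₀ + ∑ n (f ∘ Fin.suc ∘ punchIn c)) ∎
    where
    f₀ = f Fin.zero

  indicator : Bool → ℤ
  indicator true  = + 1
  indicator false = + 0

  count≡∑ : ∀ n (f : Fin n → Bool) → + count n f ≡ ∑ n (indicator ∘ f)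
  count≡∑ zero    f = refl
  count≡∑ (suc n) f with f Fin.zero
  ... | true  = trans (ℤₚ.pos-+ 1 (count n (f ∘ Fin.suc))) (cong (_+_ (+ 1)) (count≡∑ n (f ∘ Fin.suc)))
  ... | false = trans (count≡∑ n (f ∘ Fin.suc)) (sym (ℤₚ.+-identityˡ _))

  argmin : ∀ n (key : Fin (suc n) → ℕ) → Σ[ c ∈ Fin (suc n) ] (∀ d → key c ℕ.≤ key d)
  argmin zero    key = Fin.zero , λ { Fin.zero → ℕₚ.≤-refl }
  argmin (suc n) key with argmin n (key ∘ Fin.suc)
  ... | c , min with ℕₚ.≤-total (key Fin.zero) (key (Fin.suc c))
  ...   | inj₁ k₀≤ = Fin.zero    , λ { Fin.zero → ℕₚ.≤-refl ; (Fin.suc d) → ℕₚ.≤-trans k₀≤ (min d) }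
  ...   | inj₂ ≤k₀ = Fin.suc c , λ { Fin.zero → ≤k₀      ; (Fin.suc d) → min d }

  sortBy : ∀ n (key : Fin n → ℕ) → Σ[ σ ∈ Permutation′ n ]
           (∀ c d → toℕ c ℕ.≤ toℕ d → key (σ ⟨$⟩ʳ c) ℕ.≤ key (σ ⟨$⟩ʳ d)) ×
           (∀ f → ∑ n (f ∘ (σ ⟨$⟩ʳ_)) ≡ ∑ n f)
  sortBy zero    key = Perm.id , (λ ()) , λ f → refl
  sortBy (suc n) key with argmin n key
  ... | c₀ , min with sortBy n (key ∘ punchIn c₀)
  ...   | τ , τ-sorted , τ-∑ = σ , sorted , ∑-invariant
    where
    σ = insert Fin.zero c₀ τ
    sorted : ∀ c d → toℕ c ℕ.≤ toℕ d → key (σ ⟨$⟩ʳ c) ℕ.≤ key (σ ⟨$⟩ʳ d)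
    sorted Fin.zero    d           _           = min _
    sorted (Fin.suc c) (Fin.suc d) (ℕ.s≤s c≤d) = τ-sorted c d c≤d
    ∑-invariant : ∀ f → ∑ (suc n) (f ∘ (σ ⟨$⟩ʳ_)) ≡ ∑ (suc n) f
    ∑-invariant f = trans (cong (_+_ (f c₀)) (τ-∑ (f ∘ punchIn c₀))) (sym (∑-punchIn n c₀ f))

module Signs where

  open import Data.Integer using (ℤ; +_; -_; -[1+_]; ∣_∣; _-_; _*_; _≤_; +≤+)
  import Data.Integer.Properties as ℤₚ
  open import Data.Integer.Tactic.RingSolver using (solve-∀)
  open import Data.Bool using (Bool; true; false)
  open import Data.Sum using (_⊎_; inj₁; inj₂)
  open import Relation.Binary.PropositionalEquality

  IsSign : ℤ → Set
  IsSign z = z ≡ + 1 ⊎ z ≡ - + 1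

  sgn-isSign : ∀ b → IsSign (sgn b)
  sgn-isSign true  = inj₁ refl
  sgn-isSign false = inj₂ refl

  isSign-* : ∀ {x y} → IsSign x → IsSign y → IsSign (x * y)
  isSign-* (inj₁ refl) (inj₁ refl) = inj₁ refl
  isSign-* (inj₁ refl) (inj₂ refl) = inj₂ refl
  isSign-* (inj₂ refl) (inj₁ refl) = inj₂ refl
  isSign-* (inj₂ refl) (inj₂ refl) = inj₁ refl

  isSign-square : ∀ {w} → IsSign w → w * w ≡ + 1
  isSign-square (inj₁ refl) = refl
  isSign-square (inj₂ refl) = refl

  isSign-cancel : ∀ {w} → IsSign w → ∀ z → w * (w * z) ≡ z
  isSign-cancel (inj₁ refl) = solve-∀
  isSign-cancel (inj₂ refl) = solve-∀

  isNonNeg : ℤ → Bool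
  isNonNeg (+ _)    = true
  isNonNeg -[1+ _ ] = false

  sgn-isNonNeg-* : ∀ z → sgn (isNonNeg z) * z ≡ + ∣ z ∣
  sgn-isNonNeg-* (+ n)      = ℤₚ.*-identityˡ (+ n)
  sgn-isNonNeg-* -[1+ n ] = ℤₚ.-1*i≡-i -[1+ n ]

  sgn-isNonNeg : ∀ {z} → IsSign z → sgn (isNonNeg z) ≡ z
  sgn-isNonNeg (inj₁ refl) = refl
  sgn-isNonNeg (inj₂ refl) = refl

  slack : ℤ → ℤ → ℤ
  slack u v = (+ 1 - u) * (+ 1 - v)

  slack-nonNeg : ∀ {u v} → IsSign u → IsSign v → + 0 ≤ slack u v
  slack-nonNeg (inj₁ refl) _           = +≤+ ℕ.z≤n
  slack-nonNeg (inj₂ refl) (inj₁ refl) = +≤+ ℕ.z≤n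
  slack-nonNeg (inj₂ refl) (inj₂ refl) = +≤+ ℕ.z≤n

module SignTable where

  open import Data.Integer using (ℤ; +_; _+_; _-_; _*_)
  open import Data.Fin as Fin using (Fin)
  open import Data.Fin.Properties using (all?)
  open import Data.Bool using (Bool; true; false)
  open import Data.Vec using (Vec; _∷_; []; tabulate)
  open import Relation.Binary.PropositionalEquality
  open import Relation.Nullary.Decidable using (⌊_⌋; toWitness)
  open FiniteSums using (indicator)
  open Signs

  entry : Fin 5 → Fin 12 → ℤ
  entry s b = sgn (sign s b)

  entryTriple : Fin 5 → Fin 12 → ℤ
  entryTriple t b = entry (# 1) b * entry (# 2) b * entry t b

  -- (1 + e x)(1 + f y) with xy replaced by x + y − 1, valid when (1 − x)(1 − y) = 0; z homogenises.
  affine : Fin 12 → ℤ → ℤ → ℤ → ℤ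
  affine b z x y = (+ 1 - e * f) * z + (e + e * f) * x + (f + e * f) * y
    where
    e = entryTriple (# 3) b
    f = entryTriple (# 4) b

  weight : Fin 12 → ℤ → ℤ → ℤ → ℤ → ℤ
  weight b a c x y = (+ 1 + entry (# 1) b * a) * (+ 1 + entry (# 2) b * c) * affine b (+ 1) x y

  weight-indicator : ∀ b′ b →
    weight b (entry (# 1) b′) (entry (# 2) b′) (entryTriple (# 3) b′) (entryTriple (# 4) b′)
      ≡ + 16 * indicator ⌊ b′ Fin.≟ b ⌋
  weight-indicator = toWitness {a? = all? λ b′ → all? λ b → _ ℤ.≟ _} _

  column : Fin 12 → Vec Bool 5
  column b = tabulate (λ s → sign s b)

  -- The four patterns with nonzero slack are not columns of the table; they are sent to block 0.
  decode : Bool → Bool → Bool → Bool → Fin 12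
  decode true  true  true  true  = # 0
  decode true  true  true  false = # 1
  decode true  true  false true  = # 2
  decode true  false true  false = # 3
  decode true  false false true  = # 4
  decode true  false false false = # 5
  decode false true  true  false = # 6
  decode false true  false true  = # 7
  decode false true  false false = # 8
  decode false false true  true  = # 9
  decode false false true  false = # 10
  decode false false false true  = # 11
  decode _     _     _     _     = # 0

  decode-column : ∀ a b c d → slack (sgn a * sgn b * sgn c) (sgn a * sgn b * sgn d) ≡ + 0 →
                  column (decode a b c d) ≡ true ∷ a ∷ b ∷ c ∷ d ∷ []
  decode-column true  true  true  true  _  = refl
  decode-column true  true  true  false _  = refl
  decode-column true  true  false true  _  = refl
  decode-column true  true  false false ()
  decode-column true  false true  true  ()
  decode-column true  false true  false _  = refl
  decode-column true  false false true  _  = refl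
  decode-column true  false false false _  = refl
  decode-column false true  true  true  ()
  decode-column false true  true  false _  = refl
  decode-column false true  false true  _  = refl
  decode-column false true  false false _  = refl
  decode-column false false true  true  _  = refl
  decode-column false false true  false _  = refl
  decode-column false false false true  _  = refl
  decode-column false false false false ()

-- Rows 0, …, 4 stand for i, j, k, p, q.
module Normalised (n : ℕ) (ν : Fin 5 → Fin n → ℤ)
  (ν-isSign : ∀ s r → Signs.IsSign (ν s r))
  (ν₀≡1 : ∀ r → ν (# 0) r ≡ + 1)
  (⟂ : ∀ s t → s ≢ t → ∑ n (λ r → ν s r ℤ.* ν t r) ≡ + 0)
  where

  open import Data.Integer using (_+_; _-_; _*_; _≤_)
  import Data.Integer.Properties as ℤₚ
  open import Data.Integer.Tactic.RingSolver using (solve-∀)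
  import Data.Fin as Fin
  open import Data.Bool using (Bool)
  open import Data.Vec using (lookup; tabulate; tail; _∷_)
  open import Data.Vec.Properties using (lookup∘tabulate)
  open import Relation.Binary.PropositionalEquality
  open import Relation.Nullary.Decidable using (⌊_⌋)
  open ≡-Reasoning
  open FiniteSums
  open Signs
  open SignTable

  triple : Fin 5 → Fin n → ℤ
  triple t r = ν (# 1) r * ν (# 2) r * ν t r

  u v : Fin n → ℤ
  u = triple (# 3)
  v = triple (# 4)

  ∑ν≡0 : ∀ s → # 0 ≢ s → ∑ n (ν s) ≡ + 0
  ∑ν≡0 s 0≢s = trans (∑-cong n λ r → trans (sym (ℤₚ.*-identityˡ (ν s r))) (cong (_* ν s r) (sym (ν₀≡1 r))))
                     (⟂ (# 0) s 0≢s)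

  u*v≡ν₃*ν₄ : ∀ r → u r * v r ≡ ν (# 3) r * ν (# 4) r
  u*v≡ν₃*ν₄ r = trans (regroup (ν (# 1) r) (ν (# 2) r) (ν (# 3) r) (ν (# 4) r))
                      (isSign-cancel (isSign-* (ν-isSign (# 1) r) (ν-isSign (# 2) r)) _)
    where
    regroup : ∀ a b c d → a * b * c * (a * b * d) ≡ a * b * (a * b * (c * d))
    regroup = solve-∀

  ∑-slack : ∑ n (λ r → slack (u r) (v r)) ≡ + n - (∑ n u + ∑ n v)
  ∑-slack = begin
    ∑ n (λ r → slack (u r) (v r))
      ≡⟨ ∑-cong n (λ r → trans (expand (u r) (v r)) (cong (_+_ (+ 1 - u r - v r)) (u*v≡ν₃*ν₄ r))) ⟩
    ∑ n (λ r → + 1 - u r - v r + ν (# 3) r * ν (# 4) r)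
      ≡⟨ ∑-distrib-+ n _ _ ⟩
    ∑ n (λ r → + 1 - u r - v r) + ∑ n (λ r → ν (# 3) r * ν (# 4) r)
      ≡⟨ cong₂ _+_ (trans (∑-distrib‿- n _ v) (cong (_- ∑ n v) (∑-distrib‿- n _ u)))
                   (⟂ (# 3) (# 4) λ ()) ⟩
    ∑ n (λ _ → + 1) - ∑ n u - ∑ n v + + 0
      ≡⟨ ℤₚ.+-identityʳ _ ⟩
    ∑ n (λ _ → + 1) - ∑ n u - ∑ n v
      ≡⟨ cong (λ N → N - ∑ n u - ∑ n v) (∑-one n) ⟩
    + n - ∑ n u - ∑ n v
      ≡⟨ minus-sum (+ n) (∑ n u) (∑ n v) ⟩
    + n - (∑ n u + ∑ n v) ∎
    where
    expand : ∀ x y → (+ 1 - x) * (+ 1 - y) ≡ + 1 - x - y + x * y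
    expand = solve-∀
    minus-sum : ∀ a x y → a - x - y ≡ a - (x + y)
    minus-sum = solve-∀

  triple-isSign : ∀ t r → IsSign (triple t r)
  triple-isSign t r = isSign-* (isSign-* (ν-isSign (# 1) r) (ν-isSign (# 2) r)) (ν-isSign t r)

  slack-uv-nonNeg : ∀ r → + 0 ≤ slack (u r) (v r)
  slack-uv-nonNeg r = slack-nonNeg (triple-isSign (# 3) r) (triple-isSign (# 4) r)

  ∑u+∑v≤n : ∑ n u + ∑ n v ≤ + n
  ∑u+∑v≤n = ℤₚ.0≤i-j⇒j≤i (subst (+ 0 ≤_) ∑-slack (∑-nonNeg n slack-uv-nonNeg))

  quadrant : ℤ → ℤ → Fin n → ℤ
  quadrant κ₁ κ₂ r = (+ 1 + κ₁ * ν (# 1) r) * (+ 1 + κ₂ * ν (# 2) r)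

  ∑-quadrant-one : ∀ κ₁ κ₂ → ∑ n (λ r → quadrant κ₁ κ₂ r * + 1) ≡ + n
  ∑-quadrant-one κ₁ κ₂ = trans
    (∑-quadrant n κ₁ κ₂ (ν (# 1)) (ν (# 2)) (λ _ → + 1)
      (trans (∑-cong n (λ r → ℤₚ.*-identityʳ (ν (# 1) r))) (∑ν≡0 (# 1) λ ()))
      (trans (∑-cong n (λ r → ℤₚ.*-identityʳ (ν (# 2) r))) (∑ν≡0 (# 2) λ ()))
      (trans (∑-cong n (λ r → ℤₚ.*-identityʳ (ν (# 1) r * ν (# 2) r))) (⟂ (# 1) (# 2) λ ())))
    (∑-one n)

  ∑-quadrant-triple : ∀ t → # 0 ≢ t → # 1 ≢ t → # 2 ≢ t → ∀ κ₁ κ₂ →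
                      ∑ n (λ r → quadrant κ₁ κ₂ r * triple t r) ≡ ∑ n (triple t)
  ∑-quadrant-triple t 0≢t 1≢t 2≢t κ₁ κ₂ = ∑-quadrant n κ₁ κ₂ (ν (# 1)) (ν (# 2)) (triple t)
    (trans (∑-cong n ν₁*triple) (⟂ (# 2) t 2≢t))
    (trans (∑-cong n ν₂*triple) (⟂ (# 1) t 1≢t))
    (trans (∑-cong n ν₁*ν₂*triple) (∑ν≡0 t 0≢t))
    where
    regroup₁ : ∀ a b c → a * (a * b * c) ≡ a * (a * (b * c))
    regroup₁ = solve-∀
    regroup₂ : ∀ a b c → b * (a * b * c) ≡ b * (b * (a * c))
    regroup₂ = solve-∀
    ν₁*triple : ∀ r → ν (# 1) r * triple t r ≡ ν (# 2) r * ν t r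
    ν₁*triple r = trans (regroup₁ (ν (# 1) r) (ν (# 2) r) (ν t r)) (isSign-cancel (ν-isSign (# 1) r) _)
    ν₂*triple : ∀ r → ν (# 2) r * triple t r ≡ ν (# 1) r * ν t r
    ν₂*triple r = trans (regroup₂ (ν (# 1) r) (ν (# 2) r) (ν t r)) (isSign-cancel (ν-isSign (# 2) r) _)
    ν₁*ν₂*triple : ∀ r → ν (# 1) r * ν (# 2) r * triple t r ≡ ν t r
    ν₁*ν₂*triple r = isSign-cancel (isSign-* (ν-isSign (# 1) r) (ν-isSign (# 2) r)) (ν t r)

  module Tight (tight : ∑ n u + ∑ n v ≡ + n) where

    slack≡0 : ∀ r → slack (u r) (v r) ≡ + 0
    slack≡0 = ∑-nonNeg-≡0 n slack-uv-nonNeg (begin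
      ∑ n (λ r → slack (u r) (v r)) ≡⟨ ∑-slack ⟩
      + n - (∑ n u + ∑ n v)         ≡⟨ cong (λ x → + n - x) tight ⟩
      + n - + n                     ≡⟨ ℤₚ.+-inverseʳ (+ n) ⟩
      + 0                           ∎)

    bit : Fin 5 → Fin n → Bool
    bit s r = isNonNeg (ν s r)

    block : Fin n → Fin 12
    block r = decode (bit (# 1) r) (bit (# 2) r) (bit (# 3) r) (bit (# 4) r)

    column-block : ∀ r → column (block r) ≡ tabulate (λ s → bit s r)
    column-block r =
      trans (decode-column (bit (# 1) r) (bit (# 2) r) (bit (# 3) r) (bit (# 4) r) slack-bits)
            (cong (_∷ tail (tabulate (λ s → bit s r))) (sym (cong isNonNeg (ν₀≡1 r))))
      where
      sgn-bit : ∀ s → sgn (bit s r) ≡ ν s r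
      sgn-bit s = sgn-isNonNeg (ν-isSign s r)
      slack-bits : slack (sgn (bit (# 1) r) * sgn (bit (# 2) r) * sgn (bit (# 3) r))
                         (sgn (bit (# 1) r) * sgn (bit (# 2) r) * sgn (bit (# 4) r)) ≡ + 0
      slack-bits rewrite sgn-bit (# 1) | sgn-bit (# 2) | sgn-bit (# 3) | sgn-bit (# 4) = slack≡0 r

    ν≡entry : ∀ s r → ν s r ≡ entry s (block r)
    ν≡entry s r = begin
      ν s r                                        ≡⟨ sym (sgn-isNonNeg (ν-isSign s r)) ⟩
      sgn (bit s r)                                ≡⟨ cong sgn (sym (lookup∘tabulate (λ s → bit s r) s)) ⟩
      sgn (lookup (tabulate (λ s → bit s r)) s)    ≡⟨ cong (λ w → sgn (lookup w s)) (sym (column-block r)) ⟩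
      sgn (lookup (column (block r)) s)            ≡⟨ cong sgn (lookup∘tabulate (λ s → sign s (block r)) s) ⟩
      entry s (block r)                            ∎

    triple≡entryTriple : ∀ t r → triple t r ≡ entryTriple t (block r)
    triple≡entryTriple t r = cong₂ _*_ (cong₂ _*_ (ν≡entry (# 1) r) (ν≡entry (# 2) r)) (ν≡entry t r)

    block-indicator : ∀ b r → weight b (ν (# 1) r) (ν (# 2) r) (u r) (v r)
                              ≡ + 16 * indicator ⌊ block r Fin.≟ b ⌋
    block-indicator b r = begin
      weight b (ν (# 1) r) (ν (# 2) r) (u r) (v r)
        ≡⟨ cong₂ (λ a c → weight b a c (u r) (v r)) (ν≡entry (# 1) r) (ν≡entry (# 2) r) ⟩
      weight b (entry (# 1) b′) (entry (# 2) b′) (u r) (v r)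
        ≡⟨ cong₂ (weight b _ _) (triple≡entryTriple (# 3) r) (triple≡entryTriple (# 4) r) ⟩
      weight b (entry (# 1) b′) (entry (# 2) b′) (entryTriple (# 3) b′) (entryTriple (# 4) b′)
        ≡⟨ weight-indicator b′ b ⟩
      + 16 * indicator ⌊ b′ Fin.≟ b ⌋ ∎
      where
      b′ = block r

    block-size : ∀ b → + 16 * + count n (λ r → ⌊ block r Fin.≟ b ⌋) ≡ affine b (+ n) (∑ n u) (∑ n v)
    block-size b = begin
      + 16 * + count n (λ r → ⌊ block r Fin.≟ b ⌋)
        ≡⟨ cong (+ 16 *_) (count≡∑ n _) ⟩
      + 16 * ∑ n (λ r → indicator ⌊ block r Fin.≟ b ⌋)
        ≡⟨ sym (∑-*ˡ n (+ 16) _) ⟩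
      ∑ n (λ r → + 16 * indicator ⌊ block r Fin.≟ b ⌋)
        ≡⟨ ∑-cong n (λ r → sym (block-indicator b r)) ⟩
      ∑ n (λ r → weight b (ν (# 1) r) (ν (# 2) r) (u r) (v r))
        ≡⟨ ∑-cong n (λ r → distribute (Q r) (+ 1 - e * f) (e + e * f) (f + e * f) (u r) (v r)) ⟩
      ∑ n (λ r → affine b (Q r * + 1) (Q r * u r) (Q r * v r))
        ≡⟨ ∑-linear n (+ 1 - e * f) (e + e * f) (f + e * f) _ _ _ ⟩
      affine b (∑ n (λ r → Q r * + 1)) (∑ n (λ r → Q r * u r)) (∑ n (λ r → Q r * v r))
        ≡⟨ cong (λ z → affine b z (∑ n (λ r → Q r * u r)) (∑ n (λ r → Q r * v r)))
                (∑-quadrant-one κ₁ κ₂) ⟩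
      affine b (+ n) (∑ n (λ r → Q r * u r)) (∑ n (λ r → Q r * v r))
        ≡⟨ cong₂ (affine b (+ n)) (∑-quadrant-triple (# 3) (λ ()) (λ ()) (λ ()) κ₁ κ₂)
                                  (∑-quadrant-triple (# 4) (λ ()) (λ ()) (λ ()) κ₁ κ₂) ⟩
      affine b (+ n) (∑ n u) (∑ n v) ∎
      where
      κ₁ = entry (# 1) b
      κ₂ = entry (# 2) b
      e = entryTriple (# 3) b
      f = entryTriple (# 4) b
      Q = quadrant κ₁ κ₂
      distribute : ∀ q α β γ x y →
                   q * (α * + 1 + β * x + γ * y) ≡ α * (q * + 1) + β * (q * x) + γ * (q * y)
      distribute = solve-∀

module QuadrupleTypes (m : ℕ) where

  open import Data.Nat using (suc)
  open import Data.Integer using (_+_; _-_; _*_; _≤_; -1ℤ)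
  import Data.Integer.Properties as ℤₚ
  open import Data.Integer.Tactic.RingSolver using (solve-∀)
  open import Data.Rational as ℚ using (ℚ; _/_; toℚᵘ)
  import Data.Rational.Properties as ℚₚ
  open import Data.Rational.Unnormalised as ℚᵘ using (mkℚᵘ; *≡*; *≤*)
  import Data.Rational.Unnormalised.Properties as ℚᵘₚ
  open import Algebra.Properties.AbelianGroup ℚₚ.+-0-abelianGroup using (xyx⁻¹≈y)
  open import Data.Fin using (zero; suc)
  open import Data.Vec using (lookup)
  open import Relation.Binary.PropositionalEquality
  open SignTable using (affine)

  n : ℕ
  n = 4 ℕ.* m

  type : ℕ → ℚ
  type x = (+ n - + x) / 8

  +n≡4*m : + n ≡ + 4 * + m
  +n≡4*m = ℤₚ.pos-* 4 m

  toℚᵘ-/ : ∀ a d → toℚᵘ (a / suc d) ℚᵘ.≃ mkℚᵘ a d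
  toℚᵘ-/ a d = ℚₚ.toℚᵘ-fromℚᵘ (mkℚᵘ a d)

  toℚᵘ-type+type : ∀ x y → toℚᵘ (type x ℚ.+ type y) ℚᵘ.≃ mkℚᵘ (+ n - + x) 7 ℚᵘ.+ mkℚᵘ (+ n - + y) 7
  toℚᵘ-type+type x y = ℚᵘₚ.≃-trans (ℚₚ.toℚᵘ-homo-+ (type x) (type y))
                                   (ℚᵘₚ.+-cong (toℚᵘ-/ (+ n - + x) 7) (toℚᵘ-/ (+ n - + y) 7))

  half≤type+type : ∀ x y → + x + + y ≤ + n → + m / 2 ℚ.≤ type x ℚ.+ type y
  half≤type+type x y x+y≤n = ℚₚ.toℚᵘ-cancel-≤
    (ℚᵘₚ.≤-respˡ-≃ (ℚᵘₚ.≃-sym (toℚᵘ-/ (+ m) 1)) (ℚᵘₚ.≤-respʳ-≃ (ℚᵘₚ.≃-sym (toℚᵘ-type+type x y)) (*≤* cross)))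
    where
    open ℤₚ.≤-Reasoning
    regroup : ∀ a x y →
              a * + 64 + + 16 * (+ 4 * a - (x + y)) ≡ ((+ 4 * a - x) * + 8 + (+ 4 * a - y) * + 8) * + 2
    regroup = solve-∀
    0≤16[n-x-y] : + 0 ≤ + 16 * (+ n - (+ x + + y))
    0≤16[n-x-y] = ℤₚ.*-monoˡ-≤-nonNeg (+ 16) (ℤₚ.i≤j⇒0≤j-i x+y≤n)
    cross : + m * + 64 ≤ ((+ n - + x) * + 8 + (+ n - + y) * + 8) * + 2
    cross = begin
      + m * + 64
        ≤⟨ ℤₚ.i≤i+j _ _ {{ℤ.nonNegative 0≤16[n-x-y]}} ⟩
      + m * + 64 + + 16 * (+ n - (+ x + + y))
        ≡⟨ cong (λ N → + m * + 64 + + 16 * (N - (+ x + + y))) +n≡4*m ⟩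
      + m * + 64 + + 16 * (+ 4 * + m - (+ x + + y))
        ≡⟨ regroup (+ m) (+ x) (+ y) ⟩
      ((+ 4 * + m - + x) * + 8 + (+ 4 * + m - + y) * + 8) * + 2
        ≡⟨ cong (λ N → ((N - + x) * + 8 + (N - + y) * + 8) * + 2) (sym +n≡4*m) ⟩
      ((+ n - + x) * + 8 + (+ n - + y) * + 8) * + 2 ∎

  type+type≡half⇒ : ∀ x y → type x ℚ.+ type y ≡ + m / 2 → + x + + y ≡ + n
  type+type≡half⇒ x y eq
    with ℚᵘₚ.≃-trans (ℚᵘₚ.≃-sym (toℚᵘ-type+type x y)) (ℚᵘₚ.≃-trans (ℚₚ.toℚᵘ-cong eq) (toℚᵘ-/ (+ m) 1))
  ... | *≡* cross = ℤₚ.*-cancelʳ-≡ (+ x + + y) (+ n) (+ 16) (begin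
    (+ x + + y) * + 16                                         ≡⟨ isolate (+ n) (+ x) (+ y) ⟩
    + n * + 32 - ((+ n - + x) * + 8 + (+ n - + y) * + 8) * + 2 ≡⟨ cong (λ z → + n * + 32 - z) cross ⟩
    + n * + 32 - + m * + 64                                    ≡⟨ cong (λ N → N * + 32 - + m * + 64) +n≡4*m ⟩
    + 4 * + m * + 32 - + m * + 64                              ≡⟨ halve (+ m) ⟩
    + 4 * + m * + 16                                           ≡⟨ cong (_* + 16) (sym +n≡4*m) ⟩
    + n * + 16                                                 ∎)
    where
    open ≡-Reasoning
    isolate : ∀ N x y → (x + y) * + 16 ≡ N * + 32 - ((N - x) * + 8 + (N - y) * + 8) * + 2
    isolate = solve-∀
    halve : ∀ a → + 4 * a * + 32 - a * + 64 ≡ + 4 * a * + 16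
    halve = solve-∀

  fraction-≡ : ∀ a b c d → a * + suc d ≡ b * + suc c → a / suc c ≡ b / suc d
  fraction-≡ a b c d eq =
    ℚₚ.toℚᵘ-injective (ℚᵘₚ.≃-trans (toℚᵘ-/ a c) (ℚᵘₚ.≃-trans (*≡* eq) (ℚᵘₚ.≃-sym (toℚᵘ-/ b d))))

  half-type≡type : ∀ x y → type x ℚ.+ type y ≡ + m / 2 → + m / 2 ℚ.- type x ≡ type y
  half-type≡type x y eq = trans (cong (ℚ._- type x) (sym eq)) (xyx⁻¹≈y (type x) (type y))

  size-both : ∀ x y N → + x + + y ≡ + n → + 16 * + N ≡ affine (# 0) (+ n) (+ x) (+ y) → + N / 1 ≡ + m / 2
  size-both x y N x+y≡n 16N≡ = fraction-≡ (+ N) (+ m) 0 1 (ℤₚ.*-cancelʳ-≡ _ _ (+ 8) (begin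
    + N * + 2 * + 8                            ≡⟨ ℤₚ.*-assoc (+ N) (+ 2) (+ 8) ⟩
    + N * + 16                                 ≡⟨ ℤₚ.*-comm (+ N) (+ 16) ⟩
    + 16 * + N                                 ≡⟨ 16N≡ ⟩
    affine (# 0) (+ n) (+ x) (+ y)             ≡⟨ collect (+ n) (+ x) (+ y) ⟩
    + 2 * (+ x + + y)                          ≡⟨ cong (+ 2 *_) (trans x+y≡n +n≡4*m) ⟩
    + 2 * (+ 4 * + m)                          ≡⟨ regroup (+ m) ⟩
    + m * + 1 * + 8                            ∎))
    where
    open ≡-Reasoning
    collect : ∀ N x y → (+ 1 - + 1 * + 1) * N + (+ 1 + + 1 * + 1) * x + (+ 1 + + 1 * + 1) * y ≡ + 2 * (x + y)
    collect = solve-∀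
    regroup : ∀ a → + 2 * (+ 4 * a) ≡ a * + 1 * + 8
    regroup = solve-∀

  size-type : ∀ z N → + 16 * + N ≡ + 2 * (+ n - + z) → + N / 1 ≡ type z
  size-type z N 16N≡ = fraction-≡ (+ N) (+ n - + z) 0 7 (ℤₚ.*-cancelʳ-≡ _ _ (+ 2) (begin
    + N * + 8 * + 2              ≡⟨ regroup (+ N) ⟩
    + 16 * + N                   ≡⟨ 16N≡ ⟩
    + 2 * (+ n - + z)            ≡⟨ regroup′ (+ n - + z) ⟩
    (+ n - + z) * + 1 * + 2      ∎))
    where
    open ≡-Reasoning
    regroup : ∀ a → a * + 8 * + 2 ≡ + 16 * a
    regroup = solve-∀
    regroup′ : ∀ a → + 2 * a ≡ a * + 1 * + 2
    regroup′ = solve-∀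

  size-p : ∀ x y N → + 16 * + N ≡ affine (# 1) (+ n) (+ x) (+ y) → + N / 1 ≡ type y
  size-p x y N 16N≡ = size-type y N (trans 16N≡ (collect (+ n) (+ x) (+ y)))
    where
    collect : ∀ N x y → (+ 1 - + 1 * -1ℤ) * N + (+ 1 + + 1 * -1ℤ) * x + (-1ℤ + + 1 * -1ℤ) * y ≡ + 2 * (N - y)
    collect = solve-∀

  size-q : ∀ x y N → + 16 * + N ≡ affine (# 3) (+ n) (+ x) (+ y) → + N / 1 ≡ type x
  size-q x y N 16N≡ = size-type x N (trans 16N≡ (collect (+ n) (+ x) (+ y)))
    where
    collect : ∀ N x y → (+ 1 - -1ℤ * + 1) * N + (-1ℤ + -1ℤ * + 1) * x + (+ 1 + -1ℤ * + 1) * y ≡ + 2 * (N - x)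
    collect = solve-∀

  block-fraction : ∀ x y N b → type x ℚ.+ type y ≡ + m / 2 → + 16 * + N ≡ affine b (+ n) (+ x) (+ y) →
                   + N / 1 ≡ lookup (blockSizes m (type x) (type y)) b
  block-fraction x y N b tight = go b
    where
    x+y≡n = type+type≡half⇒ x y tight
    t′≡s = half-type≡type x y tight
    s′≡t = half-type≡type y x (trans (ℚₚ.+-comm (type y) (type x)) tight)
    go : ∀ b → + 16 * + N ≡ affine b (+ n) (+ x) (+ y) → + N / 1 ≡ lookup (blockSizes m (type x) (type y)) b
    go zero = size-both x y N x+y≡n
    go (suc zero) h = trans (size-p x y N h) (sym t′≡s)
    go (suc (suc zero)) h = trans (size-q x y N h) (sym s′≡t)
    go (suc (suc (suc zero))) = size-q x y N
    go (suc (suc (suc (suc zero)))) = size-p x y N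
    go (suc (suc (suc (suc (suc zero))))) = size-both x y N x+y≡n
    go (suc (suc (suc (suc (suc (suc zero)))))) = size-q x y N
    go (suc (suc (suc (suc (suc (suc (suc zero))))))) = size-p x y N
    go (suc (suc (suc (suc (suc (suc (suc (suc zero)))))))) = size-both x y N x+y≡n
    go (suc (suc (suc (suc (suc (suc (suc (suc (suc zero))))))))) = size-both x y N x+y≡n
    go (suc (suc (suc (suc (suc (suc (suc (suc (suc (suc zero)))))))))) h = trans (size-p x y N h) (sym t′≡s)
    go (suc (suc (suc (suc (suc (suc (suc (suc (suc (suc (suc zero))))))))))) h = trans (size-q x y N h) (sym s′≡t)

module HadamardQuintuple (m : ℕ) (H : Matrix (4 ℕ.* m)) (hadamard : IsHadamard (4 ℕ.* m) H)
  (i j k p q : Fin (4 ℕ.* m)) (distinct : Distinct5 i j k p q) where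

  open import Data.Integer using (_+_; _*_; _≤_)
  import Data.Integer.Properties as ℤₚ
  open import Data.Integer.Tactic.RingSolver using (solve-∀)
  open import Data.Fin as Fin using (toℕ)
  open import Data.Fin.Permutation using (_⟨$⟩ʳ_)
  open import Data.Bool using (Bool; true)
  open import Data.Vec using (lookup; _∷_; [])
  open import Data.Vec.Relation.Unary.Unique.Propositional using (Unique)
  open import Data.Vec.Relation.Unary.Unique.Propositional.Properties using (lookup-injective)
  open import Data.Vec.Relation.Unary.AllPairs using (_∷_; [])
  open import Data.Vec.Relation.Unary.All using (_∷_; [])
  open import Data.Product using (_,_; proj₁; proj₂)
  open import Data.Empty using (⊥-elim)
  open import Function using (_∘_)
  open import Relation.Nullary using (yes; no)
  open import Relation.Nullary.Decidable using (⌊_⌋)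
  open import Relation.Binary.PropositionalEquality
  open import Data.Rational as ℚ using (_/_)
  open FiniteSums
  open Signs
  open SignTable using (affine)

  n : ℕ
  n = 4 ℕ.* m

  H-isSign : ∀ u r → IsSign (H u r)
  H-isSign = proj₁ hadamard

  H-⟂ : ∀ {u w} → u ≢ w → ∑ n (λ r → H u r * H w r) ≡ + 0
  H-⟂ {u} {w} u≢w with u Fin.≟ w | proj₂ hadamard u w
  ... | yes u≡w | _  = ⊥-elim (u≢w u≡w)
  ... | no _    | eq = eq

  rows : Fin 5 → Fin n
  rows = rows5 i j k p q

  rows-injective : ∀ s t → rows s ≡ rows t → s ≡ t
  rows-injective = lookup-injective (unique distinct)
    where
    unique : Distinct5 i j k p q → Unique (i ∷ j ∷ k ∷ p ∷ q ∷ [])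
    unique (i≢j , i≢k , i≢p , i≢q , j≢k , j≢p , j≢q , k≢p , k≢q , p≢q) =
      (i≢j ∷ i≢k ∷ i≢p ∷ i≢q ∷ []) ∷ (j≢k ∷ j≢p ∷ j≢q ∷ []) ∷ (k≢p ∷ k≢q ∷ []) ∷ (p≢q ∷ []) ∷ [] ∷ []

  X : Fin n → ℤ
  X l = ∑ n (λ r → H i r * H j r * H k r * H l r)

  ε : Fin 5 → Bool
  ε s = lookup (true ∷ true ∷ true ∷ isNonNeg (X p) ∷ isNonNeg (X q) ∷ []) s

  δ : Fin n → Bool
  δ r = isNonNeg (H i r)

  ν : Fin 5 → Fin n → ℤ
  ν s r = sgn (ε s) * sgn (δ r) * H (rows s) r

  sgn-δ : ∀ r → sgn (δ r) ≡ H i r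
  sgn-δ r = sgn-isNonNeg (H-isSign i r)

  ν-isSign : ∀ s r → IsSign (ν s r)
  ν-isSign s r = isSign-* (isSign-* (sgn-isSign (ε s)) (sgn-isSign (δ r))) (H-isSign (rows s) r)

  ν₀≡1 : ∀ r → ν (# 0) r ≡ + 1
  ν₀≡1 r = trans (cong (_* H i r) (trans (ℤₚ.*-identityˡ (sgn (δ r))) (sgn-δ r))) (isSign-square (H-isSign i r))

  ν-⟂ : ∀ s t → s ≢ t → ∑ n (λ r → ν s r * ν t r) ≡ + 0
  ν-⟂ s t s≢t = begin
    ∑ n (λ r → ν s r * ν t r)
      ≡⟨ ∑-cong n (λ r → trans (regroup (sgn (ε s)) (sgn (ε t)) (sgn (δ r)) (H (rows s) r) (H (rows t) r))
                                (cong (sgn (ε s) * sgn (ε t) *_) (isSign-cancel (sgn-isSign (δ r)) _))) ⟩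
    ∑ n (λ r → sgn (ε s) * sgn (ε t) * (H (rows s) r * H (rows t) r))
      ≡⟨ ∑-*ˡ n (sgn (ε s) * sgn (ε t)) (λ r → H (rows s) r * H (rows t) r) ⟩
    sgn (ε s) * sgn (ε t) * ∑ n (λ r → H (rows s) r * H (rows t) r)
      ≡⟨ cong (sgn (ε s) * sgn (ε t) *_) (H-⟂ (s≢t ∘ rows-injective s t)) ⟩
    sgn (ε s) * sgn (ε t) * + 0
      ≡⟨ ℤₚ.*-zeroʳ (sgn (ε s) * sgn (ε t)) ⟩
    + 0 ∎
    where
    open ≡-Reasoning
    regroup : ∀ a b d x y → a * d * x * (b * d * y) ≡ a * b * (d * (d * (x * y)))
    regroup = solve-∀

  open Normalised n ν ν-isSign ν₀≡1 ν-⟂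

  ∑-triple : ∀ t → ∑ n (triple t) ≡ sgn (ε t) * X (rows t)
  ∑-triple t = trans (∑-cong n pointwise) (∑-*ˡ n (sgn (ε t)) _)
    where
    regroup : ∀ e d x y z → + 1 * d * x * (+ 1 * d * y) * (e * d * z) ≡ e * (d * (d * (d * x * y * z)))
    regroup = solve-∀
    pointwise : ∀ r → triple t r ≡ sgn (ε t) * (H i r * H j r * H k r * H (rows t) r)
    pointwise r = begin
      triple t r
        ≡⟨ cong (λ d → + 1 * d * H j r * (+ 1 * d * H k r) * (sgn (ε t) * d * H (rows t) r)) (sgn-δ r) ⟩
      + 1 * H i r * H j r * (+ 1 * H i r * H k r) * (sgn (ε t) * H i r * H (rows t) r)
        ≡⟨ regroup (sgn (ε t)) (H i r) (H j r) (H k r) (H (rows t) r) ⟩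
      sgn (ε t) * (H i r * (H i r * (H i r * H j r * H k r * H (rows t) r)))
        ≡⟨ cong (sgn (ε t) *_) (isSign-cancel (H-isSign i r) _) ⟩
      sgn (ε t) * (H i r * H j r * H k r * H (rows t) r) ∎
      where open ≡-Reasoning

  Pp Pq : ℕ
  Pp = P n H i j k p
  Pq = P n H i j k q

  ∑u≡Pp : ∑ n u ≡ + Pp
  ∑u≡Pp = trans (∑-triple (# 3)) (sgn-isNonNeg-* (X p))

  ∑v≡Pq : ∑ n v ≡ + Pq
  ∑v≡Pq = trans (∑-triple (# 4)) (sgn-isNonNeg-* (X q))

  open QuadrupleTypes m using (type; half≤type+type; type+type≡half⇒; block-fraction)

  types-bound : + m / 2 ℚ.≤ type Pp ℚ.+ type Pq
  types-bound = half≤type+type Pp Pq (subst₂ (λ x y → x + y ≤ + n) ∑u≡Pp ∑v≡Pq ∑u+∑v≤n)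

  block-structure : type Pp ℚ.+ type Pq ≡ + m / 2 → BlockStructure m H i j k p q (type Pp) (type Pq)
  block-structure tight =
    ε , δ ∘ (σ ⟨$⟩ʳ_) , σ , block ∘ (σ ⟨$⟩ʳ_) , sorted , sizes , λ a c → ν≡entry a (σ ⟨$⟩ʳ c)
    where
    open Tight (subst₂ (λ x y → x + y ≡ + n) (sym ∑u≡Pp) (sym ∑v≡Pq) (type+type≡half⇒ Pp Pq tight))
    sort = sortBy n (toℕ ∘ block)
    σ = proj₁ sort
    sorted = proj₁ (proj₂ sort)
    size : Fin 12 → ℕ
    size b = count n (λ r → ⌊ block r Fin.≟ b ⌋)
    size-σ : ∀ b → count n (λ c → ⌊ block (σ ⟨$⟩ʳ c) Fin.≟ b ⌋) ≡ size b
    size-σ b = ℤₚ.+-injective (trans (count≡∑ n _) (trans (proj₂ (proj₂ sort) _) (sym (count≡∑ n _))))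
    sizes : ∀ b → + count n (λ c → ⌊ block (σ ⟨$⟩ʳ c) Fin.≟ b ⌋) / 1
                  ≡ lookup (blockSizes m (type Pp) (type Pq)) b
    sizes b = trans (cong (λ N → + N / 1) (size-σ b))
                    (block-fraction Pp Pq (size b) b tight
                       (trans (block-size b) (cong₂ (affine b (+ n)) ∑u≡Pp ∑v≡Pq)))

open import Data.Nat using (ℕ; _≤_; _*_)
open import Data.Integer using (+_)
open import Data.Rational using (_/_; _+_) renaming (_≤_ to _≤ℚ_)
open import Data.Fin using (Fin)
open import Data.Product using (_×_; _,_)
open import Relation.Binary.PropositionalEquality using (_≡_)

lemma3p1 : (m : ℕ) → 1 ≤ m → (H : Matrix (4 * m)) → IsHadamard (4 * m) H →
    (i j k p q : Fin (4 * m)) → Distinct5 i j k p q →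
    ((+ m / 2) ≤ℚ (T (4 * m) H i j k p + T (4 * m) H i j k q)) ×
    (T (4 * m) H i j k p + T (4 * m) H i j k q ≡ + m / 2 →
      BlockStructure m H i j k p q (T (4 * m) H i j k p) (T (4 * m) H i j k q))
lemma3p1 m _ H hadamard i j k p q distinct = types-bound , block-structure
  where open HadamardQuintuple m H hadamard i j k p q distinct
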